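{- Let $v_i$ and $v_j$ be adjacent vertices of a rectangular dualizable graph $\mathcal{G}$ and let $s=|N(v_i)\cap N(v_j)|$. Then $(v_i,v_j)$ is an interior edge of $\mathcal{G}$ if and only if $s=2$.
   Context: All graphs considered are connected plane graphs whose interior faces (regions) are all triangles. A planar graph is a rectangular dualizable graph (RDG) if its dual graph can be realized as a rectangular floorplan (a partition of a rectangle into rectangles such that no four of them meet at a point); equivalently its dual is a plane graph whose edges can be oriented horizontally or vertically, with four-sided internal regions and a rectangular enclosure. $N(v)$ denotes the set of neighbours of $v$. An exterior edge lies on the exterior (unbounded) face; an interior edge is an edge that is not exterior. -}

module Defs where

open import Data.Nat using (ℕ; zero; suc; _<_; _≤_; _⊔_; _⊓_; _∸_)
open import Data.Nat.Properties using (_≟_; _<?_)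
open import Data.Fin using (Fin)
open import Data.Fin.Subset using (Subset)
open import Data.Vec using (tabulate)
open import Data.Bool using (Bool)
open import Data.Product using (_×_; Σ; ∃; ∃-syntax; _,_)
open import Data.Sum using (_⊎_)
open import Relation.Binary.PropositionalEquality using (_≡_; _≢_)
open import Relation.Nullary using (¬_; Dec; does)
open import Relation.Nullary.Decidable using (_×-dec_; _⊎-dec_)

-- Rectangular floorplans with integer coordinates.
-- The enclosure is [0,W] × [0,H]; room i is [x₀ i, x₁ i] × [y₀ i, y₁ i].
-- The unit cell (a , b) is the square [a,a+1] × [b,b+1].

record Floorplan (n : ℕ) : Set where
  field
    W H : ℕ
    x₀ x₁ y₀ y₁ : Fin n → ℕ
    x-pos : ∀ i → x₀ i < x₁ i
    y-pos : ∀ i → y₀ i < y₁ i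
    x-in  : ∀ i → x₁ i ≤ W
    y-in  : ∀ i → y₁ i ≤ H

  InRoom : Fin n → ℕ → ℕ → Set
  InRoom i a b = (x₀ i ≤ a × a < x₁ i) × (y₀ i ≤ b × b < y₁ i)

  field
    cover    : ∀ a b → a < W → b < H → ∃[ i ] InRoom i a b
    disjoint : ∀ i j a b → InRoom i a b → InRoom j a b → i ≡ j
    -- no four rooms meet at a point: for every interior lattice point
    -- (a , b) the four unit cells around it do not lie in four pairwise
    -- distinct rooms
    no-four : ∀ a b → 0 < a → a < W → 0 < b → b < H →
              ∀ i j k l →
              InRoom i (a ∸ 1) (b ∸ 1) → InRoom j a (b ∸ 1) →
              InRoom k (a ∸ 1) b → InRoom l a b →
              ¬ (i ≢ j × i ≢ k × i ≢ l × j ≢ k × j ≢ l × k ≢ l)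

module _ {n : ℕ} (F : Floorplan n) where
  open Floorplan F

  LeftOf : Fin n → Fin n → Set
  LeftOf i j = x₁ i ≡ x₀ j × y₀ i < y₁ j × y₀ j < y₁ i

  Below : Fin n → Fin n → Set
  Below i j = y₁ i ≡ y₀ j × x₀ i < x₁ j × x₀ j < x₁ i

  -- adjacency in the dual graph 𝒢 of the floorplan (vertices = rooms)
  Adj : Fin n → Fin n → Set
  Adj i j = (LeftOf i j ⊎ LeftOf j i) ⊎ (Below i j ⊎ Below j i)

  adj? : ∀ i j → Dec (Adj i j)
  adj? i j = (lo i j ⊎-dec lo j i) ⊎-dec (be i j ⊎-dec be j i)
    where
    lo : ∀ i j → Dec (LeftOf i j)
    lo i j = (x₁ i ≟ x₀ j) ×-dec ((y₀ i <? y₁ j) ×-dec (y₀ j <? y₁ i))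
    be : ∀ i j → Dec (Below i j)
    be i j = (y₁ i ≟ y₀ j) ×-dec ((x₀ i <? x₁ j) ×-dec (x₀ j <? x₁ i))

  commonNbrs : Fin n → Fin n → Subset n
  commonNbrs i j = tabulate λ k → does (adj? i k ×-dec adj? j k)

  -- The edge (v_i , v_j) of 𝒢 lies on the exterior face of 𝒢 iff the
  -- wall segment shared by rooms i and j has an endpoint on the
  -- boundary of the enclosing rectangle.
  ExteriorEdge : Fin n → Fin n → Set
  ExteriorEdge i j =
      ((LeftOf i j ⊎ LeftOf j i) ×
        ((y₀ i ⊔ y₀ j ≡ 0) ⊎ (y₁ i ⊓ y₁ j ≡ H)))
    ⊎ ((Below i j ⊎ Below j i) ×
        ((x₀ i ⊔ x₀ j ≡ 0) ⊎ (x₁ i ⊓ x₁ j ≡ W)))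

  InteriorEdge : Fin n → Fin n → Set
  InteriorEdge i j = ¬ ExteriorEdge i j

{-# OPTIONS --safe #-}
-- Let i be left of j, sharing the wall segment {x} × [b, t].  A common
-- neighbour of i and j must touch the wall from above at height t or from
-- below at height b, and it then occupies one of the two unit cells flanking
-- the wall just above t or just below b.  Conversely, if t < H the rooms
-- covering the two cells above the wall produce a common neighbour, and
-- there is only one such room: two different ones would meet i and j at
-- the point (x , t), four rooms at a point.  Likewise below b when 0 < b.
-- So there are exactly two common neighbours if the wall touches neither
-- the bottom nor the top of the enclosure, and at most one otherwise.
-- Transposing the floorplan and swapping i and j reduce the other
-- adjacencies to this one.
module Submission where

open import Defs
open import Level using (0ℓ)
open import Data.Nat using (ℕ; zero; suc; pred; _<_; _≤_; _⊔_; _⊓_; z≤n; s≤s; s≤s⁻¹; >-nonZero)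
open import Data.Nat.Properties
open import Data.Fin as Fin using (Fin)
open import Data.Fin.Properties as Finₚ using ()
open import Data.Fin.Subset using (∣_∣)
open import Data.Vec using (tabulate)
open import Data.Product as Prod using (_×_; _,_; proj₁; proj₂; ∃-syntax)
open import Data.Sum as Sum using (_⊎_; inj₁; inj₂; [_,_]′)
open import Function using (_∘_; id)
open import Function.Bundles using (_⇔_; mk⇔; Equivalence)
open import Relation.Nullary using (¬_; yes; no; does; contradiction)
open import Relation.Nullary.Decidable using (_×-dec_; decidable-stable)
open import Relation.Unary using (Pred; Decidable; _≐_)
open import Relation.Binary.PropositionalEquality using (_≡_; _≢_; refl; sym; trans; cong; subst; subst₂)

private
  variable
    n : ℕ
    A : Set

record ExactlyTwo (P : Pred A 0ℓ) : Set where
  field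
    fst snd : A
    fst≢snd : fst ≢ snd
    P-fst   : P fst
    P-snd   : P snd
    only    : ∀ {x} → P x → x ≡ fst ⊎ x ≡ snd

AtMostOne : Pred A 0ℓ → Set
AtMostOne P = ∀ {x y} → P x → P y → x ≡ y

ExactlyTwo-resp : {P Q : Pred A 0ℓ} → P ≐ Q → ExactlyTwo P → ExactlyTwo Q
ExactlyTwo-resp (P⊆Q , Q⊆P) two = record
  { fst = fst ; snd = snd ; fst≢snd = fst≢snd
  ; P-fst = P⊆Q P-fst ; P-snd = P⊆Q P-snd ; only = only ∘ Q⊆P }
  where open ExactlyTwo two

Dichotomy : Set → Pred A 0ℓ → Set
Dichotomy E P = (¬ E → ExactlyTwo P) × (E → AtMostOne P)

Dichotomy-resp : ∀ {E E′} {P Q : Pred A 0ℓ} → E ⇔ E′ → P ≐ Q → Dichotomy E P → Dichotomy E′ Q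
Dichotomy-resp E⇔E′ P≐Q (two , one) =
  (λ ¬E′ → ExactlyTwo-resp P≐Q (two (¬E′ ∘ to))) ,
  (λ E′ Qx Qy → one (from E′) (proj₂ P≐Q Qx) (proj₂ P≐Q Qy))
  where open Equivalence E⇔E′

count-none : ∀ {n} {P : Pred (Fin n) 0ℓ} (P? : Decidable P) →
             (∀ k → ¬ P k) → ∣ tabulate (does ∘ P?) ∣ ≡ 0
count-none {zero}  P? ∅ = refl
count-none {suc n} P? ∅ with P? Fin.zero
... | yes P0 = contradiction P0 (∅ Fin.zero)
... | no  _  = count-none (P? ∘ Fin.suc) (∅ ∘ Fin.suc)

count-one : ∀ {n} {P : Pred (Fin n) 0ℓ} (P? : Decidable P) {a} →
            P a → (∀ {k} → P k → k ≡ a) → ∣ tabulate (does ∘ P?) ∣ ≡ 1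
count-one P? {Fin.zero} Pa only with P? Fin.zero
... | yes _   = cong suc (count-none (P? ∘ Fin.suc) (λ k → Finₚ.0≢1+n ∘ sym ∘ only))
... | no ¬P0  = contradiction Pa ¬P0
count-one P? {Fin.suc a} Pa only with P? Fin.zero
... | yes P0 = contradiction (only P0) Finₚ.0≢1+n
... | no  _  = count-one (P? ∘ Fin.suc) Pa (Finₚ.suc-injective ∘ only)

count-two : ∀ {n} {P : Pred (Fin n) 0ℓ} (P? : Decidable P) →
            ExactlyTwo P → ∣ tabulate (does ∘ P?) ∣ ≡ 2
count-two P? two = pair {P? = P?} fst snd fst≢snd P-fst P-snd only
  where
  open ExactlyTwo two
  pair : ∀ {n} {P : Pred (Fin n) 0ℓ} {P? : Decidable P} a b → a ≢ b → P a → P b →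
         (∀ {k} → P k → k ≡ a ⊎ k ≡ b) → ∣ tabulate (does ∘ P?) ∣ ≡ 2
  pair Fin.zero Fin.zero a≢b _ _ _ = contradiction refl a≢b
  pair {P? = P?} Fin.zero (Fin.suc b) _ Pa Pb only with P? Fin.zero
  ... | yes _  = cong suc (count-one (P? ∘ Fin.suc) Pb
                   ([ (λ ()) , Finₚ.suc-injective ]′ ∘ only))
  ... | no ¬P0 = contradiction Pa ¬P0
  pair {P? = P?} (Fin.suc a) Fin.zero _ Pa Pb only with P? Fin.zero
  ... | yes _  = cong suc (count-one (P? ∘ Fin.suc) Pa
                   ([ Finₚ.suc-injective , (λ ()) ]′ ∘ only))
  ... | no ¬P0 = contradiction Pb ¬P0
  pair {P? = P?} (Fin.suc a) (Fin.suc b) a≢b Pa Pb only with P? Fin.zero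
  ... | yes P0 = [ (λ ()) , (λ ()) ]′ (only P0)
  ... | no  _  = pair {P? = P? ∘ Fin.suc} a b (a≢b ∘ cong Fin.suc) Pa Pb
                   (Sum.map Finₚ.suc-injective Finₚ.suc-injective ∘ only)

count-≤1 : ∀ {n} {P : Pred (Fin n) 0ℓ} (P? : Decidable P) →
           AtMostOne P → ∣ tabulate (does ∘ P?) ∣ ≤ 1
count-≤1 {zero}  P? unique = z≤n
count-≤1 {suc n} P? unique with P? Fin.zero
... | yes P0 = ≤-reflexive (cong suc (count-none (P? ∘ Fin.suc)
                 (λ k → Finₚ.0≢1+n ∘ unique P0)))
... | no  _  = count-≤1 (P? ∘ Fin.suc) (λ Pk Pl → Finₚ.suc-injective (unique Pk Pl))

⊓-tight : ∀ {m n v} → v ≤ m → v ≤ n → m ≡ v ⊎ n ≡ v → m ⊓ n ≡ v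
⊓-tight _   v≤n (inj₁ refl) = m≤n⇒m⊓n≡m v≤n
⊓-tight v≤m _   (inj₂ refl) = m≥n⇒m⊓n≡n v≤m

⊔-tight : ∀ {m n v} → m ≤ v → n ≤ v → v ≡ m ⊎ v ≡ n → m ⊔ n ≡ v
⊔-tight _   n≤v (inj₁ refl) = m≥n⇒m⊔n≡m n≤v
⊔-tight m≤v _   (inj₂ refl) = m≤n⇒m⊔n≡n m≤v

pred<self : ∀ {m} → 0 < m → pred m < m
pred<self {suc m} _ = ≤-refl

data Consecutive : ℕ → ℕ → Set where
  up   : ∀ r → Consecutive r (suc r)
  down : ∀ r → Consecutive (suc r) r

pred-consecutive : ∀ {m} → 0 < m → Consecutive (pred m) m
pred-consecutive {suc m} _ = up m

consecutive-pred : ∀ {m} → 0 < m → Consecutive m (pred m)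
consecutive-pred {suc m} _ = down m

transpose : Floorplan n → Floorplan n
transpose F = record
  { W = H ; H = W ; x₀ = y₀ ; x₁ = y₁ ; y₀ = x₀ ; y₁ = x₁
  ; x-pos = y-pos ; y-pos = x-pos ; x-in = y-in ; y-in = x-in
  ; cover    = λ a b a<H b<W → Prod.map₂ Prod.swap (cover b a b<W a<H)
  ; disjoint = λ i j a b i∋ j∋ → disjoint i j b a (Prod.swap i∋) (Prod.swap j∋)
  ; no-four  = λ a b 0<a a<H 0<b b<W i j k l i∋ j∋ k∋ l∋ (i≢j , i≢k , i≢l , j≢k , j≢l , k≢l) →
      no-four b a 0<b b<W 0<a a<H i k j l
        (Prod.swap i∋) (Prod.swap k∋) (Prod.swap j∋) (Prod.swap l∋)
        (i≢k , i≢j , i≢l , j≢k ∘ sym , k≢l , j≢l)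
  }
  where open Floorplan F

CommonNbr : Floorplan n → Fin n → Fin n → Pred (Fin n) 0ℓ
CommonNbr F i j k = Adj F i k × Adj F j k

module _ (F : Floorplan n) where
  open Floorplan F

  Adj-sym : ∀ {k l} → Adj F k l → Adj F l k
  Adj-sym = Sum.map Sum.swap Sum.swap

  Adj-irrefl : ∀ {k l} → Adj F k l → k ≢ l
  Adj-irrefl {k} (inj₁ (inj₁ (x₁≡x₀ , _))) refl = <-irrefl (sym x₁≡x₀) (x-pos k)
  Adj-irrefl {k} (inj₁ (inj₂ (x₁≡x₀ , _))) refl = <-irrefl (sym x₁≡x₀) (x-pos k)
  Adj-irrefl {k} (inj₂ (inj₁ (y₁≡y₀ , _))) refl = <-irrefl (sym y₁≡y₀) (y-pos k)
  Adj-irrefl {k} (inj₂ (inj₂ (y₁≡y₀ , _))) refl = <-irrefl (sym y₁≡y₀) (y-pos k)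

  Adj⇒x-touch : ∀ {k l} → Adj F k l → x₀ l ≤ x₁ k
  Adj⇒x-touch     (inj₁ (inj₁ (x₁k≡x₀l , _))) = ≤-reflexive (sym x₁k≡x₀l)
  Adj⇒x-touch {k} {l} (inj₁ (inj₂ (x₁l≡x₀k , _))) =
    <⇒≤ (<-trans (x-pos l) (subst (_< x₁ k) (sym x₁l≡x₀k) (x-pos k)))
  Adj⇒x-touch     (inj₂ (inj₁ (_ , _ , x₀l<x₁k))) = <⇒≤ x₀l<x₁k
  Adj⇒x-touch     (inj₂ (inj₂ (_ , x₀l<x₁k , _))) = <⇒≤ x₀l<x₁k

  InRoom⇒x<W : ∀ {k x y} → InRoom k x y → x < W
  InRoom⇒x<W {k} ((_ , x<x₁) , _) = <-≤-trans x<x₁ (x-in k)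

  InRoom⇒y<H : ∀ {k x y} → InRoom k x y → y < H
  InRoom⇒y<H {k} (_ , (_ , y<y₁)) = <-≤-trans y<y₁ (y-in k)

  vacant⇒≢ : ∀ {k l x y} → ¬ InRoom k x y → InRoom l x y → k ≢ l
  vacant⇒≢ ¬k∋ l∋ refl = ¬k∋ l∋

  beside⇒LeftOf : ∀ {k l x y} → InRoom k x y → InRoom l (suc x) y → k ≢ l → LeftOf F k l
  beside⇒LeftOf {k} {l} {x} {y} ((x₀k≤x , x<x₁k) , (y₀k≤y , y<y₁k))
                 l∋@((x₀l≤1+x , 1+x<x₁l) , (y₀l≤y , y<y₁l)) k≢l =
    trans x₁k≡1+x (sym x₀l≡1+x) , ≤-<-trans y₀k≤y y<y₁l , ≤-<-trans y₀l≤y y<y₁k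
    where
    x₁k≡1+x : x₁ k ≡ suc x
    x₁k≡1+x = ≤-antisym (≮⇒≥ λ 1+x<x₁k →
      k≢l (disjoint k l (suc x) y ((m≤n⇒m≤1+n x₀k≤x , 1+x<x₁k) , (y₀k≤y , y<y₁k)) l∋)) x<x₁k
    x₀l≡1+x : x₀ l ≡ suc x
    x₀l≡1+x = ≤-antisym x₀l≤1+x (≮⇒≥ λ x₀l<1+x →
      k≢l (disjoint k l x y ((x₀k≤x , x<x₁k) , (y₀k≤y , y<y₁k))
                            ((s≤s⁻¹ x₀l<1+x , <-trans (n<1+n x) 1+x<x₁l) , (y₀l≤y , y<y₁l))))

  four-corners : ∀ {i j k l x r r'} → Consecutive r r' →
                 InRoom i x r → InRoom j (suc x) r → InRoom k x r' → InRoom l (suc x) r' →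
                 i ≢ j → i ≢ k → i ≢ l → j ≢ k → j ≢ l → k ≡ l
  four-corners {i} {j} {k} {l} {x} (up r) i∋ j∋ k∋ l∋ i≢j i≢k i≢l j≢k j≢l =
    decidable-stable (k Finₚ.≟ l) λ k≢l →
      no-four (suc x) (suc r) (s≤s z≤n) (InRoom⇒x<W j∋) (s≤s z≤n) (InRoom⇒y<H k∋)
        i j k l i∋ j∋ k∋ l∋ (i≢j , i≢k , i≢l , j≢k , j≢l , k≢l)
  four-corners {i} {j} {k} {l} {x} (down r) i∋ j∋ k∋ l∋ i≢j i≢k i≢l j≢k j≢l =
    decidable-stable (k Finₚ.≟ l) λ k≢l →
      no-four (suc x) (suc r) (s≤s z≤n) (InRoom⇒x<W j∋) (s≤s z≤n) (InRoom⇒y<H i∋)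
        k l i j k∋ l∋ i∋ j∋ (k≢l , i≢k ∘ sym , j≢k ∘ sym , i≢l ∘ sym , j≢l ∘ sym , i≢j)

module _ (F : Floorplan n) where
  open Floorplan F

  Adj⇒y-touch : ∀ {k l} → Adj F k l → y₀ l ≤ y₁ k
  Adj⇒y-touch = Adj⇒x-touch (transpose F) ∘ Sum.swap

  stacked⇒Below : ∀ {k l x y} → InRoom k x y → InRoom l x (suc y) → k ≢ l → Below F k l
  stacked⇒Below k∋ l∋ = beside⇒LeftOf (transpose F) (Prod.swap k∋) (Prod.swap l∋)

  consecutive⇒Adj : ∀ {k l x r r'} → Consecutive r r' →
                    InRoom k x r → InRoom l x r' → k ≢ l → Adj F k l
  consecutive⇒Adj (up r)   k∋ l∋ k≢l = inj₂ (inj₁ (stacked⇒Below k∋ l∋ k≢l))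
  consecutive⇒Adj (down r) k∋ l∋ k≢l = inj₂ (inj₂ (stacked⇒Below l∋ k∋ (k≢l ∘ sym)))

  LeftOf⇒vertical-contact : ∀ {i j k} → LeftOf F i j → CommonNbr F i j k →
                            (Below F i k ⊎ Below F j k) ⊎ (Below F k i ⊎ Below F k j)
  LeftOf⇒vertical-contact _ (inj₂ (inj₁ i/k) , _) = inj₁ (inj₁ i/k)
  LeftOf⇒vertical-contact _ (inj₂ (inj₂ k/i) , _) = inj₂ (inj₁ k/i)
  LeftOf⇒vertical-contact {i} {j} (x₁i≡x₀j , _) (inj₁ (inj₂ (x₁k≡x₀i , _)) , j~k) =
    contradiction (Adj⇒x-touch F (Adj-sym F j~k))
      (<⇒≱ (subst₂ _<_ (sym x₁k≡x₀i) x₁i≡x₀j (x-pos i)))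
  LeftOf⇒vertical-contact _ (inj₁ (inj₁ _) , inj₂ (inj₁ j/k)) = inj₁ (inj₂ j/k)
  LeftOf⇒vertical-contact _ (inj₁ (inj₁ _) , inj₂ (inj₂ k/j)) = inj₂ (inj₂ k/j)
  LeftOf⇒vertical-contact {i} {j} (x₁i≡x₀j , _)
                          (inj₁ (inj₁ (x₁i≡x₀k , _)) , inj₁ (inj₁ (x₁j≡x₀k , _))) =
    contradiction (x-pos j) (<-irrefl (trans (sym x₁i≡x₀j) (trans x₁i≡x₀k (sym x₁j≡x₀k))))
  LeftOf⇒vertical-contact {i} {j} {k} (x₁i≡x₀j , _)
                          (inj₁ (inj₁ (x₁i≡x₀k , _)) , inj₁ (inj₂ (x₁k≡x₀j , _))) =
    contradiction (x-pos k) (<-irrefl (trans (sym x₁i≡x₀k) (trans x₁i≡x₀j (sym x₁k≡x₀j))))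

-- The wall of i|j is the line x = suc c over the rows [b, t): along it i fills
-- column c and j column suc c.
module Wall (F : Floorplan n) {i j : Fin n} (i|j : LeftOf F i j) where
  open Floorplan F

  c : ℕ
  c = pred (x₀ j)

  x₀i<x₀j : x₀ i < x₀ j
  x₀i<x₀j = subst (x₀ i <_) (proj₁ i|j) (x-pos i)

  x₀j≡1+c : x₀ j ≡ suc c
  x₀j≡1+c = sym (suc-pred (x₀ j) {{>-nonZero (m<n⇒0<n x₀i<x₀j)}})

  x₁i≡1+c : x₁ i ≡ suc c
  x₁i≡1+c = trans (proj₁ i|j) x₀j≡1+c

  t b : ℕ
  t = y₁ i ⊓ y₁ j
  b = y₀ i ⊔ y₀ j

  b<t : b < t
  b<t = ⊔-lub (⊓-glb (y-pos i) (proj₁ (proj₂ i|j))) (⊓-glb (proj₂ (proj₂ i|j)) (y-pos j))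

  0<t : 0 < t
  0<t = m<n⇒0<n b<t

  i∋ : ∀ {y} → b ≤ y → y < t → InRoom i c y
  i∋ b≤y y<t = (<⇒≤pred x₀i<x₀j , ≤-reflexive (sym x₁i≡1+c))
             , (≤-trans (m≤m⊔n _ _) b≤y , <-≤-trans y<t (m⊓n≤m _ _))

  j∋ : ∀ {y} → b ≤ y → y < t → InRoom j (suc c) y
  j∋ b≤y y<t = (≤-reflexive x₀j≡1+c , subst (_< x₁ j) x₀j≡1+c (x-pos j))
             , (≤-trans (m≤n⊔m _ _) b≤y , <-≤-trans y<t (m⊓n≤n _ _))

  i∌ : ∀ {y} → ¬ InRoom i (suc c) y
  i∌ ((_ , 1+c<x₁i) , _) = <-irrefl (sym x₁i≡1+c) 1+c<x₁i

  j∌ : ∀ {y} → ¬ InRoom j c y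
  j∌ ((x₀j≤c , _) , _) = 1+n≰n (subst (_≤ c) x₀j≡1+c x₀j≤c)

  x₀j≮x₁i : ¬ x₀ j < x₁ i
  x₀j≮x₁i = <-irrefl (sym (proj₁ i|j))

  i≢j : i ≢ j
  i≢j = Adj-irrefl F (inj₁ (inj₁ i|j))

  AtWallEnd : ℕ → Pred (Fin n) 0ℓ
  AtWallEnd r k = InRoom k c r ⊎ InRoom k (suc c) r

  AtWallEnd⇒y : ∀ {r k} → AtWallEnd r k → y₀ k ≤ r × r < y₁ k
  AtWallEnd⇒y = [ proj₂ , proj₂ ]′

  corner-exists : ∀ {r r'} → Consecutive r r' → InRoom i c r → InRoom j (suc c) r →
                  ¬ (InRoom i c r' × InRoom j (suc c) r') → r' < H →
                  ∃[ k ] CommonNbr F i j k × AtWallEnd r' k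
  corner-exists {r' = r'} rr' i∋r j∋r ¬both r'<H
    with cover c r' (InRoom⇒x<W F i∋r) r'<H | cover (suc c) r' (InRoom⇒x<W F j∋r) r'<H
  ... | k , k∋ | l , l∋ with k Finₚ.≟ i | l Finₚ.≟ j
  ... | yes refl | yes refl = contradiction (k∋ , l∋) ¬both
  ... | yes refl | no l≢j =
    l , (inj₁ (inj₁ (beside⇒LeftOf F k∋ l∋ (vacant⇒≢ F i∌ l∋)))
        , consecutive⇒Adj F rr' j∋r l∋ (l≢j ∘ sym)) , inj₂ l∋
  ... | no k≢i | yes refl =
    k , (consecutive⇒Adj F rr' i∋r k∋ (k≢i ∘ sym)
        , inj₁ (inj₂ (beside⇒LeftOf F k∋ l∋ (vacant⇒≢ F j∌ k∋ ∘ sym)))) , inj₁ k∋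
  ... | no k≢i | no l≢j =
    k , (consecutive⇒Adj F rr' i∋r k∋ (k≢i ∘ sym)
        , consecutive⇒Adj F rr' j∋r (subst (λ m → InRoom m (suc c) r') (sym k≡l) l∋) j≢k) , inj₁ k∋
    where
    j≢k : j ≢ k
    j≢k = vacant⇒≢ F j∌ k∋
    k≡l : k ≡ l
    k≡l = four-corners F rr' i∋r j∋r k∋ l∋ i≢j (k≢i ∘ sym) (vacant⇒≢ F i∌ l∋) j≢k (l≢j ∘ sym)

  corner-across : ∀ {r r' k l} → Consecutive r r' → InRoom i c r → InRoom j (suc c) r →
                  CommonNbr F i j k → CommonNbr F i j l → InRoom k c r' → InRoom l (suc c) r' → k ≡ l
  corner-across rr' i∋r j∋r (i~k , j~k) (i~l , j~l) k∋ l∋ =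
    four-corners F rr' i∋r j∋r k∋ l∋ i≢j
      (Adj-irrefl F i~k) (Adj-irrefl F i~l) (Adj-irrefl F j~k) (Adj-irrefl F j~l)

  corner-unique : ∀ {r r' k l} → Consecutive r r' → InRoom i c r → InRoom j (suc c) r →
                  CommonNbr F i j k → CommonNbr F i j l → AtWallEnd r' k → AtWallEnd r' l → k ≡ l
  corner-unique {k = k} {l} _ _ _ _ _ (inj₁ k∋) (inj₁ l∋) = disjoint k l _ _ k∋ l∋
  corner-unique {k = k} {l} _ _ _ _ _ (inj₂ k∋) (inj₂ l∋) = disjoint k l _ _ k∋ l∋
  corner-unique rr' i∋r j∋r Ck Cl (inj₁ k∋) (inj₂ l∋) = corner-across rr' i∋r j∋r Ck Cl k∋ l∋
  corner-unique rr' i∋r j∋r Ck Cl (inj₂ k∋) (inj₁ l∋) = sym (corner-across rr' i∋r j∋r Cl Ck l∋ k∋)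

  top-consecutive : Consecutive (pred t) t
  top-consecutive = pred-consecutive 0<t

  i∋top : InRoom i c (pred t)
  i∋top = i∋ (<⇒≤pred b<t) (pred<self 0<t)

  j∋top : InRoom j (suc c) (pred t)
  j∋top = j∋ (<⇒≤pred b<t) (pred<self 0<t)

  ¬both-above : ¬ (InRoom i c t × InRoom j (suc c) t)
  ¬both-above ((_ , (_ , t<y₁i)) , (_ , (_ , t<y₁j))) = <-irrefl refl (⊓-glb t<y₁i t<y₁j)

  ¬both-below : 0 < b → ¬ (InRoom i c (pred b) × InRoom j (suc c) (pred b))
  ¬both-below 0<b ((_ , (y₀i≤ , _)) , (_ , (y₀j≤ , _))) =
    <⇒≱ (pred<self 0<b) (⊔-lub y₀i≤ y₀j≤)

  top-exists : t < H → ∃[ k ] CommonNbr F i j k × AtWallEnd t k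
  top-exists = corner-exists top-consecutive i∋top j∋top ¬both-above

  top-unique : ∀ {k l} → CommonNbr F i j k → CommonNbr F i j l →
               AtWallEnd t k → AtWallEnd t l → k ≡ l
  top-unique = corner-unique top-consecutive i∋top j∋top

  bottom-exists : 0 < b → ∃[ k ] CommonNbr F i j k × AtWallEnd (pred b) k
  bottom-exists 0<b =
    corner-exists (consecutive-pred 0<b) (i∋ ≤-refl b<t) (j∋ ≤-refl b<t) (¬both-below 0<b)
      (<-trans (pred<self 0<b) (<-≤-trans b<t (≤-trans (m⊓n≤m _ _) (y-in i))))

  bottom-unique : ∀ {k l} → 0 < b → CommonNbr F i j k → CommonNbr F i j l →
                  AtWallEnd (pred b) k → AtWallEnd (pred b) l → k ≡ l
  bottom-unique 0<b = corner-unique (consecutive-pred 0<b) (i∋ ≤-refl b<t) (j∋ ≤-refl b<t)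

  straddle⇒AtWallEnd : ∀ {k r} → x₀ k ≤ suc c → suc c ≤ x₁ k → y₀ k ≤ r × r < y₁ k → AtWallEnd r k
  straddle⇒AtWallEnd {k} x₀k≤1+c 1+c≤x₁k y-span with m≤n⇒m<n∨m≡n x₀k≤1+c
  ... | inj₁ x₀k<1+c = inj₁ ((s≤s⁻¹ x₀k<1+c , 1+c≤x₁k) , y-span)
  ... | inj₂ x₀k≡1+c = inj₂ ((x₀k≤1+c , subst (_< x₁ k) x₀k≡1+c (x-pos k)) , y-span)

  CommonNbr⇒AtWallEnd : ∀ {k r} → CommonNbr F i j k → y₀ k ≤ r × r < y₁ k → AtWallEnd r k
  CommonNbr⇒AtWallEnd {k} (i~k , j~k) =
    straddle⇒AtWallEnd (subst (x₀ k ≤_) x₁i≡1+c (Adj⇒x-touch F i~k))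
                       (subst (_≤ x₁ k) x₀j≡1+c (Adj⇒x-touch F (Adj-sym F j~k)))

  height : ∀ {k} → CommonNbr F i j k → t ≡ y₀ k ⊎ b ≡ y₁ k
  height Ck@(i~k , j~k) =
    Sum.map (⊓-tight (Adj⇒y-touch F i~k) (Adj⇒y-touch F j~k) ∘ Sum.map proj₁ proj₁)
            (⊔-tight (Adj⇒y-touch F (Adj-sym F i~k)) (Adj⇒y-touch F (Adj-sym F j~k))
               ∘ Sum.map proj₁ proj₁)
            (LeftOf⇒vertical-contact F i|j Ck)

  classify : ∀ {k} → CommonNbr F i j k → AtWallEnd t k ⊎ (0 < b × AtWallEnd (pred b) k)
  classify {k} Ck with height Ck
  ... | inj₁ t≡y₀k = inj₁ (CommonNbr⇒AtWallEnd Ck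
                            (≤-reflexive (sym t≡y₀k) , subst (_< y₁ k) (sym t≡y₀k) (y-pos k)))
  ... | inj₂ b≡y₁k = inj₂ (0<b , CommonNbr⇒AtWallEnd Ck
                            (<⇒≤pred y₀k<b , subst (pred b <_) b≡y₁k (pred<self 0<b)))
    where
    y₀k<b : y₀ k < b
    y₀k<b = subst (y₀ k <_) (sym b≡y₁k) (y-pos k)
    0<b : 0 < b
    0<b = m<n⇒0<n y₀k<b

  top≢bottom : ∀ {k} → CommonNbr F i j k → AtWallEnd t k → ¬ AtWallEnd (pred b) k
  top≢bottom {k} (i~k , j~k) top bottom with AtWallEnd⇒y top | AtWallEnd⇒y bottom
  ... | _ , t<y₁k | y₀k≤pred-b , _ =
    [ Adj-irrefl F i~k ∘ sym ∘ owner i∋top , Adj-irrefl F j~k ∘ sym ∘ owner j∋top ]′ top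
    where
    owner : ∀ {m x} → InRoom m x (pred t) → InRoom k x t → k ≡ m
    owner {m} m∋ (xs , _) = disjoint k m _ _
      (xs , (≤-trans y₀k≤pred-b (pred-mono-≤ (<⇒≤ b<t)) , <-trans (pred<self 0<t) t<y₁k)) m∋

  exterior⇒b≡0⊎t≡H : ExteriorEdge F i j → b ≡ 0 ⊎ t ≡ H
  exterior⇒b≡0⊎t≡H (inj₁ (_ , b≡0⊎t≡H))  = b≡0⊎t≡H
  exterior⇒b≡0⊎t≡H (inj₂ (inj₁ (_ , _ , x₀j<x₁i) , _)) = contradiction x₀j<x₁i x₀j≮x₁i
  exterior⇒b≡0⊎t≡H (inj₂ (inj₂ (_ , x₀j<x₁i , _) , _)) = contradiction x₀j<x₁i x₀j≮x₁i

  interior⇒0<b : InteriorEdge F i j → 0 < b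
  interior⇒0<b interior = n≢0⇒n>0 (λ b≡0 → interior (inj₁ (inj₁ i|j , inj₁ b≡0)))

  interior⇒t<H : InteriorEdge F i j → t < H
  interior⇒t<H interior =
    ≤∧≢⇒< (≤-trans (m⊓n≤m _ _) (y-in i)) (λ t≡H → interior (inj₁ (inj₁ i|j , inj₂ t≡H)))

  interior⇒two : InteriorEdge F i j → ExactlyTwo (CommonNbr F i j)
  interior⇒two interior
    with top-exists (interior⇒t<H interior) | bottom-exists (interior⇒0<b interior)
  ... | a , Ca , a-top | d , Cd , d-bottom = record
    { fst = a ; snd = d ; P-fst = Ca ; P-snd = Cd
    ; fst≢snd = λ { refl → top≢bottom Ca a-top d-bottom }
    ; only    = λ Ck → Sum.map (λ k-top → top-unique Ck Ca k-top a-top)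
                               (λ (0<b , k-bottom) → bottom-unique 0<b Ck Cd k-bottom d-bottom)
                               (classify Ck)
    }

  exterior⇒atMostOne : ExteriorEdge F i j → AtMostOne (CommonNbr F i j)
  exterior⇒atMostOne exterior Ck Cl with exterior⇒b≡0⊎t≡H exterior
  ... | inj₁ b≡0 = top-unique Ck Cl (top-only Ck) (top-only Cl)
    where
    top-only : ∀ {k} → CommonNbr F i j k → AtWallEnd t k
    top-only Ck = [ id , (λ (0<b , _) → contradiction b≡0 (n>0⇒n≢0 0<b)) ]′ (classify Ck)
  ... | inj₂ t≡H with bottom-only Ck | bottom-only Cl
    where
    bottom-only : ∀ {k} → CommonNbr F i j k → 0 < b × AtWallEnd (pred b) k
    bottom-only {k} Ck = [ (λ top → contradiction t≡H (<⇒≢ (t<H top))) , id ]′ (classify Ck)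
      where
      t<H : AtWallEnd t k → t < H
      t<H top = <-≤-trans (proj₂ (AtWallEnd⇒y top)) (y-in k)
  ...   | 0<b , k-bottom | _ , l-bottom = bottom-unique 0<b Ck Cl k-bottom l-bottom

  dichotomy : Dichotomy (ExteriorEdge F i j) (CommonNbr F i j)
  dichotomy = interior⇒two , exterior⇒atMostOne

module _ (F : Floorplan n) where
  open Floorplan F

  ExteriorEdge-sym : ∀ {i j} → ExteriorEdge F i j → ExteriorEdge F j i
  ExteriorEdge-sym {i} {j} =
    Sum.map (Prod.map Sum.swap (Sum.map (trans (⊔-comm (y₀ j) (y₀ i)))
                                        (trans (⊓-comm (y₁ j) (y₁ i)))))
            (Prod.map Sum.swap (Sum.map (trans (⊔-comm (x₀ j) (x₀ i)))
                                        (trans (⊓-comm (x₁ j) (x₁ i)))))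

  Dichotomy-sym : ∀ {i j} → Dichotomy (ExteriorEdge F j i) (CommonNbr F j i) →
                  Dichotomy (ExteriorEdge F i j) (CommonNbr F i j)
  Dichotomy-sym = Dichotomy-resp (mk⇔ ExteriorEdge-sym ExteriorEdge-sym) (Prod.swap , Prod.swap)

  Dichotomy-transpose : ∀ {i j} →
                        Dichotomy (ExteriorEdge (transpose F) i j) (CommonNbr (transpose F) i j) →
                        Dichotomy (ExteriorEdge F i j) (CommonNbr F i j)
  Dichotomy-transpose = Dichotomy-resp (mk⇔ Sum.swap Sum.swap)
    (Prod.map Sum.swap Sum.swap , Prod.map Sum.swap Sum.swap)

Adj⇒Dichotomy : (F : Floorplan n) {i j : Fin n} → Adj F i j →
                Dichotomy (ExteriorEdge F i j) (CommonNbr F i j)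
Adj⇒Dichotomy F (inj₁ (inj₁ i|j)) = Wall.dichotomy F i|j
Adj⇒Dichotomy F (inj₁ (inj₂ j|i)) = Dichotomy-sym F (Wall.dichotomy F j|i)
Adj⇒Dichotomy F (inj₂ (inj₁ i/j)) = Dichotomy-transpose F (Wall.dichotomy (transpose F) i/j)
Adj⇒Dichotomy F (inj₂ (inj₂ j/i)) =
  Dichotomy-transpose F (Dichotomy-sym (transpose F) (Wall.dichotomy (transpose F) j/i))

lemma4p3 : ∀ {n : ℕ} (F : Floorplan n) (i j : Fin n) → Adj F i j →
    (InteriorEdge F i j ⇔ ∣ commonNbrs F i j ∣ ≡ 2)
lemma4p3 F i j i~j with Adj⇒Dichotomy F i~j
... | interior⇒two , exterior⇒atMostOne = mk⇔
  (count-two common? ∘ interior⇒two)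
  (λ ∣C∣≡2 exterior →
     1+n≰n (subst (_≤ 1) ∣C∣≡2 (count-≤1 common? (exterior⇒atMostOne exterior))))
  where
  common? : Decidable (CommonNbr F i j)
  common? k = adj? F i k ×-dec adj? F j k
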